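{- Let $\Sigma=(V,E,\{P_e\}_{e\in E})$ be a signature and $e\in E$. If $X\subseteq\Phi(\Sigma,\{e\})$ and $\phi\in\Phi(\Sigma)$, then $X\vdash\phi$ implies $X\vdash\Box_e\phi$.
   Context: A signature is a triple $\Sigma=(V,E,\{P_e\}_{e\in E})$ where $(V,E)$ is a connected undirected graph (loops and multiple edges allowed) and $\{P_e\}$ are pairwise disjoint sets of propositional letters. $Inc(v)$ is the set of edges incident to $v$. $\Phi(\Sigma)$ is the least set of formulas containing $\bot$ and all letters in $\bigcup_e P_e$, closed under $\to$ and under $\Box_e$ for $e\in E$. For $T\subseteq E$, $\Phi(\Sigma,T)$ is the least set containing $\bot$ and $P_t$ for $t\in T$, closed under $\to$, and containing $\Box_t\phi$ for every $t\in T$ and every $\phi\in\Phi(\Sigma)$. A path is a sequence $e_0,v_1,e_1,\dots,v_k,e_k$ ($k\ge0$) of pairwise distinct edges and pairwise distinct vertices with $e_i,e_{i+1}\in Inc(v_{i+1})$. Edge $g$ is a gateway between sets of edges $A$ and $B$ if every path starting with an edge in $A$ and ending with an edge in $B$ contains $g$. $\vdash\phi$ denotes provability in the system with axioms: all propositional tautologies of $\Phi(\Sigma)$; $\Box_e\phi\to\phi$; $\Box_e\phi\to\Box_e\Box_e\phi$; $\neg\Box_e\phi\to\Box_e\neg\Box_e\phi$; $\Box_e(\phi\to\psi)\to(\Box_e\phi\to\Box_e\psi)$; and Gateway $\Box_e(\phi\to\psi)\to(\phi\to\Box_g\psi)$ whenever $g$ is a gateway between $A,B\subseteq E$, $e\in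 A$, $\phi\in\Phi(\Sigma,A)$, $\psi\in\Phi(\Sigma,B)$; and rules Modus Ponens and Necessitation (from $\phi$ infer $\Box_e\phi$). $X\vdash\phi$ means $\phi$ is derivable from the set of assumptions $X$ together with the provable formulas, using only the Modus Ponens rule. -}

module Defs where

open import Data.Bool using (Bool; true; false; not; _∨_)
open import Data.Product using (_×_; _,_; proj₁; proj₂)
open import Data.Sum using (_⊎_)
open import Data.Unit using (⊤)
open import Data.List using (List; []; _∷_; map)
open import Data.List.Membership.Propositional using (_∈_)
open import Data.List.Relation.Unary.Unique.Propositional using (Unique)
open import Relation.Binary.PropositionalEquality using (_≡_)

module _ {V E : Set} (ends : E → V × V) where

  Inc : V → E → Set
  Inc v e = v ≡ proj₁ (ends e) ⊎ v ≡ proj₂ (ends e)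

  data Reach : V → V → Set where
    here : ∀ {v} → Reach v v
    step : ∀ {u w x} (e : E) → Inc u e → Inc w e → Reach w x → Reach u x

  Connected : Set
  Connected = ∀ u v → Reach u v

-- Signatures: letters are partitioned into the sets P_e via  owner.
-- (p ∈ P_e  iff  owner p ≡ e; this makes the P_e pairwise disjoint and
-- their union the set of all letters.)

record Signature : Set₁ where
  field
    V      : Set
    E      : Set
    ends   : E → V × V
    connected : Connected ends
    Letter : Set
    owner  : Letter → E

module _ (S : Signature) where
  open Signature S

  -- Paths  e₀, v₁, e₁, …, v_k, e_k  represented as e₀ and [(v₁,e₁),…,(v_k,e_k)]

  Linked : E → List (V × E) → Set
  Linked e [] = ⊤
  Linked e ((v , e') ∷ rest) = Inc ends v e × Inc ends v e' × Linked e' rest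

  record Path : Set where
    field
      first    : E
      steps    : List (V × E)
      linked   : Linked first steps
      edgesDistinct    : Unique (first ∷ map proj₂ steps)
      verticesDistinct : Unique (map proj₁ steps)

  lastE : E → List (V × E) → E
  lastE e [] = e
  lastE e ((v , e') ∷ rest) = lastE e' rest

  pathEdges : Path → List E
  pathEdges p = Path.first p ∷ map proj₂ (Path.steps p)

  pathLast : Path → E
  pathLast p = lastE (Path.first p) (Path.steps p)

  Gateway : E → (E → Set) → (E → Set) → Set
  Gateway g A B = (p : Path) → A (Path.first p) → B (pathLast p) → g ∈ pathEdges p

  infixr 5 _⇒_
  data Fm : Set where
    ⊥'  : Fm
    var : Letter → Fm
    _⇒_ : Fm → Fm → Fm
    □   : E → Fm → Fm

  data InΦ (T : E → Set) : Fm → Set where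
    bot : InΦ T ⊥'
    var : ∀ p → T (owner p) → InΦ T (var p)
    imp : ∀ {a b} → InΦ T a → InΦ T b → InΦ T (a ⇒ b)
    box : ∀ t φ → T t → InΦ T (□ t φ)

  ¬' : Fm → Fm
  ¬' a = a ⇒ ⊥'

  -- Propositional tautologies: letters and boxed formulas are atoms.

  eval : (Fm → Bool) → Fm → Bool
  eval v ⊥' = false
  eval v (var p) = v (var p)
  eval v (a ⇒ b) = not (eval v a) ∨ eval v b
  eval v (□ e a) = v (□ e a)

  Tautology : Fm → Set
  Tautology φ = ∀ (v : Fm → Bool) → eval v φ ≡ true

  data ⊢_ : Fm → Set₁ where
    taut : ∀ {φ} → Tautology φ → ⊢ φ
    axT  : ∀ e φ → ⊢ (□ e φ ⇒ φ)
    ax4  : ∀ e φ → ⊢ (□ e φ ⇒ □ e (□ e φ))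
    ax5  : ∀ e φ → ⊢ (¬' (□ e φ) ⇒ □ e (¬' (□ e φ)))
    axK  : ∀ e φ ψ → ⊢ (□ e (φ ⇒ ψ) ⇒ (□ e φ ⇒ □ e ψ))
    gate : ∀ (A B : E → Set) (g e : E) (φ ψ : Fm) →
           Gateway g A B → A e → InΦ A φ → InΦ B ψ →
           ⊢ (□ e (φ ⇒ ψ) ⇒ (φ ⇒ □ g ψ))
    mp   : ∀ {φ ψ} → ⊢ (φ ⇒ ψ) → ⊢ φ → ⊢ ψ
    nec  : ∀ e {φ} → ⊢ φ → ⊢ (□ e φ)

  -- Derivability from assumptions X, using Modus Ponens only
  data _⊢_ (X : Fm → Set) : Fm → Set₁ where
    hyp  : ∀ {φ} → X φ → X ⊢ φ
    thm  : ∀ {φ} → ⊢ φ → X ⊢ φ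
    mp   : ∀ {φ ψ} → X ⊢ (φ ⇒ ψ) → X ⊢ φ → X ⊢ ψ

module Submission where

-- Let Φₑ = Φ(Σ,{e}).  The key fact is that every φ ∈ Φₑ satisfies
-- ⊢ φ → □ₑφ.  This is an instance of the Gateway axiom: e is trivially a
-- gateway between {e} and any set of edges, since every path starting in
-- {e} contains its own first edge.  Taking A = B = {e} and ψ = φ gives
-- ⊢ □ₑ(φ → φ) → (φ → □ₑφ), and □ₑ(φ → φ) holds by necessitation of a
-- tautology.
--
-- The theorem then follows by induction on the derivation X ⊢ φ:
--   * an assumption φ ∈ X lies in Φₑ, so □ₑφ follows by the key fact;
--   * a theorem ⊢ φ yields ⊢ □ₑφ by necessitation;
--   * a Modus Ponens step is pushed under □ₑ by the K axiom.

open import Defs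
open import Data.Bool using (true; false)
open import Data.List.Relation.Unary.Any using (here)
open import Relation.Binary.PropositionalEquality using (_≡_; refl; sym)

module _ (S : Signature) where
  open Signature S using (E)

  only : E → E → Set
  only e t = t ≡ e

  self-gateway : (e : E) (B : E → Set) → Gateway S e (only e) B
  self-gateway e B p first≡e _ = here (sym first≡e)

  ⇒-refl-taut : (φ : Fm S) → Tautology S (φ ⇒ φ)
  ⇒-refl-taut φ v with eval S v φ
  ... | true  = refl
  ... | false = refl

  local⇒boxed : (e : E) (φ : Fm S) → InΦ S (only e) φ → ⊢_ S (φ ⇒ □ e φ)
  local⇒boxed e φ φ∈Φₑ = mp gateway-instance (nec e (taut (⇒-refl-taut φ)))
    where
    gateway-instance : ⊢_ S (□ e (φ ⇒ φ) ⇒ (φ ⇒ □ e φ))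
    gateway-instance =
      gate (only e) (only e) e e φ φ (self-gateway e (only e)) refl φ∈Φₑ φ∈Φₑ

  K-rule : ∀ {X : Fm S → Set} (e : E) {φ ψ : Fm S} →
           _⊢_ S X (□ e (φ ⇒ ψ)) → _⊢_ S X (□ e φ) → _⊢_ S X (□ e ψ)
  K-rule e {φ} {ψ} □φ⇒ψ □φ = mp (mp (thm (axK e φ ψ)) □φ⇒ψ) □φ

lemma4 : (S : Signature) (e : Signature.E S) (X : Fm S → Set) →
         (∀ ψ → X ψ → InΦ S (λ t → t ≡ e) ψ) →
         (φ : Fm S) → _⊢_ S X φ → _⊢_ S X (□ e φ)
lemma4 S e X X⊆Φₑ φ (hyp φ∈X) = mp (thm (local⇒boxed S e φ (X⊆Φₑ φ φ∈X))) (hyp φ∈X)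
lemma4 S e X X⊆Φₑ φ (thm ⊢φ)  = thm (nec e ⊢φ)
lemma4 S e X X⊆Φₑ φ (mp {ψ} ψ⇒φ ψ') =
  K-rule S e (lemma4 S e X X⊆Φₑ (ψ ⇒ φ) ψ⇒φ) (lemma4 S e X X⊆Φₑ ψ ψ')
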